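{- If $A\subseteq\mathbb{N}$ is a $C_p$-set and $n\in\mathbb{N}$, then $n^{ -1}\cdot A=\{x\in\mathbb{N}: nx\in A\}$ is a $C_p$-set.
   Context: $\mathbb{P}$ denotes the set of polynomials with integer coefficients which vanish at $0$ and map $\mathbb{N}$ into $\mathbb{N}$. An IP-set is a family $(x_\alpha)_\alpha$ indexed by nonempty finite $\alpha\subseteq\mathbb{N}$ with $x_\alpha=\sum_{t\in\alpha}x_t$ for some sequence $(x_n)$ in $\mathbb{N}$. $A\subseteq\mathbb{N}$ is a $J_p$-set if for every finite $F\subseteq\mathbb{P}$, every $l\in\mathbb{N}$ and all IP-sets $(x^i_\alpha)_\alpha$, $i=1,\dots,l$, there exist $a\in\mathbb{N}\cup\{0\}$ and nonempty finite $\beta\subseteq\mathbb{N}$ with $a+P(x^i_\beta)\in A$ for all $P\in F$, $i\le l$. In $(\beta\mathbb{N},+)$ (ultrafilters on $\mathbb{N}$, $A\in p+q$ iff $\{x:-x+A\in q\}\in p$), $\mathcal{J}_p$ is the set of ultrafilters all of whose members are $J_p$-sets; $A$ is a $C_p$-set if $A\in p$ for some idempotent ($p+p=p$) $p\in\mathcal{J}_p$. -}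

module Defs where

open import Level using (Level)
open import Data.Nat as ℕ using (ℕ; _≤_; _<_; _+_; _*_)
open import Data.Integer as ℤ using (ℤ; +_)
open import Data.List using (List; []; _∷_; length; map)
open import Data.Nat.ListAction using (sum)
open import Data.List.Relation.Unary.All using (All)
open import Data.List.Relation.Unary.Unique.Propositional using (Unique)
open import Data.Fin using (Fin)
open import Data.Product using (Σ; _×_)
open import Data.Sum using (_⊎_)
open import Data.Empty using (⊥)
open import Relation.Nullary using (¬_)
open import Relation.Binary.PropositionalEquality using (_≡_)
open import Function.Bundles using (_⇔_)

-- The paper's ℕ = {1,2,3,...}.  We use Agda's ℕ (which contains 0) and
-- represent subsets of the paper's ℕ as predicates on Agda's ℕ; the value
-- at 0 is irrelevant because all ultrafilters below contain the positives.

Subset : Set₁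
Subset = ℕ → Set

Positive : Subset
Positive x = 1 ≤ x

_⊆_ : Subset → Subset → Set
A ⊆ B = ∀ x → A x → B x

_∩_ : Subset → Subset → Subset
(A ∩ B) x = A x × B x

∁ : Subset → Subset
∁ A x = ¬ A x

∅ : Subset
∅ _ = ⊥

_⁻¹·_ : ℕ → Subset → Subset
(n ⁻¹· A) x = A (n * x)

shift : ℕ → Subset → Subset
shift x A y = A (x + y)

-- Ultrafilters on the paper's ℕ (= positive integers): ultrafilters on
-- Agda's ℕ containing the set of positive integers.
record Ultrafilter : Set₁ where
  field
    _∈U : Subset → Set
    upward : ∀ {A B} → A ⊆ B → A ∈U → B ∈U
    inter  : ∀ {A B} → A ∈U → B ∈U → (A ∩ B) ∈U
    proper : ¬ (∅ ∈U)
    ultra  : ∀ A → A ∈U ⊎ (∁ A) ∈U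
    pos    : Positive ∈U
open Ultrafilter public

_∈[_+_] : Subset → Ultrafilter → Ultrafilter → Set
A ∈[ p + q ] = _∈U p (λ x → _∈U q (shift x A))

-- p + p = p (equality of ultrafilters = same members)
Idempotent : Ultrafilter → Set₁
Idempotent p = ∀ (A : Subset) → (A ∈[ p + p ]) ⇔ _∈U p A

-- Polynomials with integer coefficients vanishing at 0:
-- the list (c₁ ∷ c₂ ∷ … ∷ c_d ∷ []) represents c₁ x + c₂ x² + … + c_d x^d.
evalP : List ℤ → ℤ → ℤ
evalP []       x = + 0
evalP (c ∷ cs) x = x ℤ.* (c ℤ.+ evalP cs x)

ℙ : Set
ℙ = Σ (List ℤ) λ cs → ∀ (m : ℕ) → 1 ≤ m → + 1 ℤ.≤ evalP cs (+ m)

_∈ℤ_ : ℤ → Subset → Set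
z ∈ℤ A = Σ ℕ λ m → (z ≡ + m) × A m

-- x_β = Σ_{t ∈ β} x_t, with β a nonempty finite set given as a
-- duplicate-free nonempty list of indices.
sumOver : (ℕ → ℕ) → List ℕ → ℕ
sumOver x β = sum (map x β)

-- J_p-sets.  An IP-set is given by its generating sequence (x_n) in ℕ
-- (positive integers); l IP-sets are a Fin l-indexed family of sequences.
JpSet : Subset → Set
JpSet A =
  (F : List ℙ) (l : ℕ) (xs : Fin l → ℕ → ℕ) → (∀ i t → 1 ≤ xs i t) →
  Σ ℕ λ a → Σ (List ℕ) λ β → (0 < length β) × Unique β ×
    All (λ P → ∀ (i : Fin l) →
               ((+ a) ℤ.+ evalP (Σ.proj₁ P) (+ sumOver (xs i) β)) ∈ℤ A) F

InJp : Ultrafilter → Set₁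
InJp p = ∀ (A : Subset) → _∈U p A → JpSet A

CpSet : Subset → Set₁
CpSet A = Σ Ultrafilter λ p → Idempotent p × InJp p × _∈U p A

-- Let p be an idempotent in 𝒥_p containing A.  Some residue class C = r + nℕ lies in p, and
-- by idempotence some x ∈ C has -x + C ∈ p; since -x + C ⊆ nℕ, we get nℕ ∈ p.  Hence
-- q = {B : n · B ∈ p} is an ultrafilter, and n⁻¹ · A ∈ q.  It is idempotent because
-- multiplication by n commutes with shifts, and it lies in 𝒥_p because a pattern
-- a + n P(x_β) ∈ n · B for the polynomials n P ∈ ℙ forces n ∣ a and gives a/n + P(x_β) ∈ B.
module Submission where

open import Defs
open import Data.Nat using (ℕ; _≤_; suc; _+_; _*_; _%_; _/_; z≤n; s≤s; NonZero; >-nonZero)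
open import Data.Nat.Properties using (*-comm; +-assoc; +-cancelˡ-≡; *-cancelˡ-≡; *-distribˡ-+; *-zeroʳ; <⇒≱)
open import Data.Nat.DivMod using (m≡m%n+[m/n]*n; m%n<n; m*n/n≡m)
open import Data.Nat.Divisibility using (_∣_; divides; ∣m+n∣m⇒∣n)
open import Data.Integer as ℤ using (+_; -[1+_])
open import Data.Integer.Properties using (pos-*; +-injective) renaming (*-zeroʳ to ℤ*-zeroʳ)
open import Data.Integer.Tactic.RingSolver using (solve-∀)
open import Data.Fin using (Fin; zero; suc; toℕ; fromℕ<)
open import Data.Fin.Properties using (toℕ-fromℕ<)
open import Data.List using ([]; _∷_; map)
import Data.List.Relation.Unary.All as All
open import Data.List.Relation.Unary.All.Properties using (map⁻)
open import Data.Product using (∃; _×_; _,_; proj₁)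
open import Data.Sum using (inj₁; inj₂; map₂)
open import Data.Unit using (⊤)
open import Data.Empty using (⊥-elim)
open import Relation.Nullary using (¬_)
open import Relation.Binary.PropositionalEquality
open import Function using (_∘_)
open import Function.Bundles using (mk⇔; Equivalence)

module _ (p : Ultrafilter) where

  everything∈ : _∈U p (λ _ → ⊤)
  everything∈ = upward p _ (pos p)

  ∈-stable : ∀ {A} → ¬ ¬ _∈U p A → _∈U p A
  ∈-stable {A} ¬¬A with ultra p A
  ... | inj₁ A∈ = A∈
  ... | inj₂ ∁A∈ = ⊥-elim (¬¬A λ A∈ → proper p (upward p (λ _ (a , ¬a) → ¬a a) (inter p A∈ ∁A∈)))

  const∈⇒¬¬ : ∀ {P : Set} → _∈U p (λ _ → P) → ¬ ¬ P
  const∈⇒¬¬ P∈ ¬P = proper p (upward p (λ _ → ¬P) P∈)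

  ⋃-Fin∈⇒∈ : ∀ {k} (f : Fin k → Subset) → _∈U p (λ x → ∃ λ i → f i x) → ∃ λ i → _∈U p (f i)
  ⋃-Fin∈⇒∈ {ℕ.zero} f ⋃∈ = ⊥-elim (proper p (upward p (λ { x (() , _) }) ⋃∈))
  ⋃-Fin∈⇒∈ {suc k}  f ⋃∈ with ultra p (f zero)
  ... | inj₁ f₀∈ = zero , f₀∈
  ... | inj₂ ∁f₀∈ with ⋃-Fin∈⇒∈ (f ∘ suc) (upward p others (inter p ⋃∈ ∁f₀∈))
    where
    others : ((λ x → ∃ λ i → f i x) ∩ ∁ (f zero)) ⊆ (λ x → ∃ λ i → f (suc i) x)
    others x ((zero  , fx) , ¬f₀x) = ⊥-elim (¬f₀x fx)
    others x ((suc i , fx) , _)    = i , fx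
  ... | i , fᵢ∈ = suc i , fᵢ∈

  residueClass∈ : ∀ N .{{_ : NonZero N}} → ∃ λ r → _∈U p (λ x → x % N ≡ r)
  residueClass∈ N with ⋃-Fin∈⇒∈ (λ (r : Fin N) x → x % N ≡ toℕ r) (upward p covered everything∈)
    where
    covered : (λ _ → ⊤) ⊆ (λ x → ∃ λ (r : Fin N) → x % N ≡ toℕ r)
    covered x _ = fromℕ< (m%n<n x N) , sym (toℕ-fromℕ< (m%n<n x N))
  ... | r , class∈ = toℕ r , class∈

%≡[+]%⇒∣ : ∀ N .{{_ : NonZero N}} x y → x % N ≡ (x + y) % N → N ∣ y
%≡[+]%⇒∣ N x y same = ∣m+n∣m⇒∣n (divides ((x + y) / N) quotients) (divides (x / N) refl)
  where
  open ≡-Reasoning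
  quotients : (x / N) * N + y ≡ ((x + y) / N) * N
  quotients = +-cancelˡ-≡ (x % N) _ _ (begin
    x % N + ((x / N) * N + y)    ≡⟨ sym (+-assoc (x % N) _ y) ⟩
    (x % N + (x / N) * N) + y    ≡⟨ cong (_+ y) (sym (m≡m%n+[m/n]*n x N)) ⟩
    x + y                        ≡⟨ m≡m%n+[m/n]*n (x + y) N ⟩
    (x + y) % N + ((x + y) / N) * N ≡⟨ cong (_+ ((x + y) / N) * N) (sym same) ⟩
    x % N + ((x + y) / N) * N    ∎)

idempotent⇒multiples∈ : ∀ p → Idempotent p → ∀ N .{{_ : NonZero N}} → _∈U p (N ∣_)
idempotent⇒multiples∈ p idem N with residueClass∈ p N
... | r , class∈ = ∈-stable p (const∈⇒¬¬ p (upward p multiples∈ (inter p returning∈ class∈)))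
  where
  class : Subset
  class x = x % N ≡ r
  returning∈ : _∈U p (λ x → _∈U p (shift x class))
  returning∈ = Equivalence.from (idem class) class∈
  multiples∈ : ((λ x → _∈U p (shift x class)) ∩ class) ⊆ (λ _ → _∈U p (N ∣_))
  multiples∈ x (shift∈ , x∈) = upward p (λ y x+y∈ → %≡[+]%⇒∣ N x y (trans x∈ (sym x+y∈))) shift∈

_·_ : ℕ → Subset → Subset
(n · B) y = ∃ λ x → y ≡ n * x × B x

module _ {n : ℕ} .{{_ : NonZero n}} where

  ∣⇒≡* : ∀ {y} → n ∣ y → ∃ λ x → y ≡ n * x
  ∣⇒≡* (divides x refl) = x , *-comm x n

  ·-mono : ∀ {A B} → A ⊆ B → (n · A) ⊆ (n · B)
  ·-mono A⊆B y (x , refl , ax) = x , refl , A⊆B x ax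

  ·-∩ : ∀ {A B} → ((n · A) ∩ (n · B)) ⊆ (n · (A ∩ B))
  ·-∩ {B = B} y ((x , refl , ax) , (x′ , eq , bx′)) =
    x , refl , ax , subst B (*-cancelˡ-≡ x′ x n (sym eq)) bx′

  ·-∅ : (n · ∅) ⊆ ∅
  ·-∅ y (_ , _ , ())

  ·-∁ : ∀ {A} → ((n ∣_) ∩ ∁ (n · A)) ⊆ (n · ∁ A)
  ·-∁ y (n∣y , y∉) with ∣⇒≡* n∣y
  ... | x , refl = x , refl , λ ax → y∉ (x , refl , ax)

  ·-Positive : ((n ∣_) ∩ Positive) ⊆ (n · Positive)
  ·-Positive y (n∣y , y≥1) with ∣⇒≡* n∣y
  ... | ℕ.zero , refl = ⊥-elim (<⇒≱ y≥1 (subst (_≤ 0) (sym (*-zeroʳ n)) z≤n))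
  ... | suc x  , refl = suc x , refl , s≤s z≤n

  ·-shift : ∀ {x A} → (n · shift x A) ⊆ shift (n * x) (n · A)
  ·-shift {x} y (z , refl , az) = x + z , sym (*-distribˡ-+ n x z) , az

  shift-· : ∀ {x A} → ((n ∣_) ∩ shift (n * x) (n · A)) ⊆ (n · shift x A)
  shift-· {x} {A} y (n∣y , (w , eq , aw)) with ∣⇒≡* n∣y
  ... | z , refl = z , refl , subst A (*-cancelˡ-≡ w (x + z) n (sym (trans (*-distribˡ-+ n x z) eq))) aw

  ⁻¹·-· : ∀ {A} → ((n ∣_) ∩ A) ⊆ (n · (n ⁻¹· A))
  ⁻¹·-· {A} y (n∣y , ay) with ∣⇒≡* n∣y
  ... | x , refl = x , refl , ay

evalP-map-* : ∀ c cs x → evalP (map (c ℤ.*_) cs) x ≡ c ℤ.* evalP cs x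
evalP-map-* c []       x = sym (ℤ*-zeroʳ c)
evalP-map-* c (k ∷ cs) x = begin
  x ℤ.* (c ℤ.* k ℤ.+ evalP (map (c ℤ.*_) cs) x) ≡⟨ cong (λ e → x ℤ.* (c ℤ.* k ℤ.+ e)) (evalP-map-* c cs x) ⟩
  x ℤ.* (c ℤ.* k ℤ.+ c ℤ.* evalP cs x)          ≡⟨ factor c k (evalP cs x) x ⟩
  c ℤ.* (x ℤ.* (k ℤ.+ evalP cs x))              ∎
  where
  open ≡-Reasoning
  factor : ∀ c k e x → x ℤ.* (c ℤ.* k ℤ.+ c ℤ.* e) ≡ c ℤ.* (x ℤ.* (k ℤ.+ e))
  factor = solve-∀

+1≤⇒+1≤+* : ∀ n .{{_ : NonZero n}} {e} → + 1 ℤ.≤ e → + 1 ℤ.≤ + n ℤ.* e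
+1≤⇒+1≤+* (suc m) {+ suc k} (ℤ.+≤+ _) = ℤ.+≤+ (s≤s z≤n)

_*ℙ_ : (n : ℕ) .{{_ : NonZero n}} → ℙ → ℙ
n *ℙ (cs , positive) = map (+ n ℤ.*_) cs , λ k k≥1 →
  subst (+ 1 ℤ.≤_) (sym (evalP-map-* (+ n) cs (+ k))) (+1≤⇒+1≤+* n (positive k k≥1))

+*≡+⇒≡+/ : ∀ n .{{_ : NonZero n}} z a → + n ℤ.* z ≡ + a → z ≡ + (a / n)
+*≡+⇒≡+/ n (+ k) a nk≡a = cong +_ (begin
  k             ≡⟨ sym (m*n/n≡m k n) ⟩
  k * n / n     ≡⟨ cong (_/ n) (*-comm k n) ⟩
  n * k / n     ≡⟨ cong (_/ n) (+-injective (trans (pos-* n k) nk≡a)) ⟩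
  a / n         ∎)
  where open ≡-Reasoning
+*≡+⇒≡+/ (suc m) -[1+ k ] a ()

divide-pattern : ∀ n .{{_ : NonZero n}} a e w → + a ℤ.+ + n ℤ.* e ≡ + (n * w) → + (a / n) ℤ.+ e ≡ + w
divide-pattern n a e w a+ne≡nw = begin
  + (a / n) ℤ.+ e    ≡⟨ cong (ℤ._+ e) (sym (+*≡+⇒≡+/ n (+ w ℤ.- e) a difference)) ⟩
  (+ w ℤ.- e) ℤ.+ e  ≡⟨ minus-plus (+ w) e ⟩
  + w                ∎
  where
  open ≡-Reasoning
  minus-plus : ∀ u v → (u ℤ.- v) ℤ.+ v ≡ u
  minus-plus = solve-∀
  distrib-minus : ∀ c u v → c ℤ.* (u ℤ.- v) ≡ c ℤ.* u ℤ.- c ℤ.* v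
  distrib-minus = solve-∀
  plus-minus : ∀ u v → (u ℤ.+ v) ℤ.- v ≡ u
  plus-minus = solve-∀
  difference : + n ℤ.* (+ w ℤ.- e) ≡ + a
  difference = begin
    + n ℤ.* (+ w ℤ.- e)                 ≡⟨ distrib-minus (+ n) (+ w) e ⟩
    + n ℤ.* + w ℤ.- + n ℤ.* e           ≡⟨ cong (ℤ._- + n ℤ.* e) (sym (trans a+ne≡nw (pos-* n w))) ⟩
    (+ a ℤ.+ + n ℤ.* e) ℤ.- + n ℤ.* e   ≡⟨ plus-minus (+ a) (+ n ℤ.* e) ⟩
    + a                                 ∎

module Divided (n : ℕ) .{{_ : NonZero n}} (p : Ultrafilter) (multiples∈ : _∈U p (n ∣_)) where

  divided : Ultrafilter
  divided = record
    { _∈U    = λ B → _∈U p (n · B)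
    ; upward = λ A⊆B → upward p (·-mono A⊆B)
    ; inter  = λ A∈ B∈ → upward p ·-∩ (inter p A∈ B∈)
    ; proper = λ ∅∈ → proper p (upward p ·-∅ ∅∈)
    ; ultra  = λ B → map₂ (λ ∁∈ → upward p ·-∁ (inter p multiples∈ ∁∈)) (ultra p (n · B))
    ; pos    = upward p ·-Positive (inter p multiples∈ (pos p))
    }

  divided-idempotent : Idempotent p → Idempotent divided
  divided-idempotent idem B = mk⇔ to from
    where
    to : B ∈[ divided + divided ] → _∈U divided B
    to B∈² = Equivalence.to (idem (n · B)) (upward p (λ { _ (y , refl , shift∈) → upward p ·-shift shift∈ }) B∈²)
    returning⊆ : ((n ∣_) ∩ (λ z → _∈U p (shift z (n · B)))) ⊆ (n · λ y → _∈U p (n · shift y B))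
    returning⊆ z (n∣z , shift∈) with ∣⇒≡* n∣z
    ... | y , refl = y , refl , upward p shift-· (inter p multiples∈ shift∈)
    from : _∈U divided B → B ∈[ divided + divided ]
    from B∈ = upward p returning⊆ (inter p multiples∈ (Equivalence.from (idem (n · B)) B∈))

  divided-InJp : InJp p → InJp divided
  divided-InJp jp B B∈ F l xs xs≥1 with jp (n · B) B∈ (map (n *ℙ_) F) l xs xs≥1
  ... | a , β , β-nonempty , unique , patterns = a / n , β , β-nonempty , unique , All.map (λ {P} → divide P) (map⁻ patterns)
    where
    divide : ∀ P → (∀ i → (+ a ℤ.+ evalP (proj₁ (n *ℙ P)) (+ sumOver (xs i) β)) ∈ℤ (n · B))
                   → ∀ i → (+ (a / n) ℤ.+ evalP (proj₁ P) (+ sumOver (xs i) β)) ∈ℤ B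
    divide (cs , _) n·B∋ i with n·B∋ i
    ... | _ , eq , w , refl , bw =
      w , divide-pattern n a _ w (trans (cong (λ v → + a ℤ.+ v) (sym (evalP-map-* (+ n) cs _))) eq) , bw

corollary2p14 : (A : Subset) (n : ℕ) → 1 ≤ n → CpSet A → CpSet (n ⁻¹· A)
corollary2p14 A n n≥1 (p , idem , jp , A∈) =
  divided , divided-idempotent idem , divided-InJp jp , upward p ⁻¹·-· (inter p multiples∈ A∈)
  where
  instance
    n≢0 : NonZero n
    n≢0 = >-nonZero n≥1
  multiples∈ : _∈U p (n ∣_)
  multiples∈ = idempotent⇒multiples∈ p idem n
  open Divided n p multiples∈
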